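{- Let $0\le a\le n$ with $2\mid(n-a)$, and let $\mathcal{M}_{n,a}\subseteq\mathrm{Mat}_{n\times n}(\mathbb{C})$ be the set of permutation matrices of involutions in $\mathfrak{S}_n$ with exactly $a$ fixed points. Let $I^{\mathcal{M}}_{n,a}\subseteq\mathbb{C}[\mathbf{x}_{n\times n}]$ be the ideal generated by all row sums $x_{i,1}+\cdots+x_{i,n}$, all column sums $x_{1,j}+\cdots+x_{n,j}$, all products $x_{i,j}x_{i,j'}$ and $x_{i,j}x_{i',j}$, all differences $x_{i,j}-x_{j,i}$, the diagonal sum $x_{1,1}+\cdots+x_{n,n}$, and all products $\prod_{i\in S}x_{i,i}$ with $S\subseteq[n]$, $|S|>a$. Then $I^{\mathcal{M}}_{n,a}\subseteq\mathrm{gr}\,\mathbf{I}(\mathcal{M}_{n,a})$.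
   Context: $\mathbf{x}_{n\times n}=(x_{i,j})$ is a matrix of variables. For finite $\mathcal{Z}$, $\mathbf{I}(\mathcal{Z})$ is its vanishing ideal and $\mathrm{gr}\,\mathbf{I}(\mathcal{Z})$ is the ideal generated by the top-degree homogeneous components of its nonzero elements. -}

module Defs where

open import Level using (Level; _⊔_) renaming (suc to lsuc)
open import Algebra.Bundles using (CommutativeRing)
open import Data.Nat using (ℕ; zero; suc; _<_; _≤_) renaming (_+_ to _+ℕ_)
open import Data.Fin using (Fin)
open import Data.Fin.Properties using () renaming (_≟_ to _≟F_)
open import Data.Fin.Subset using (Subset; _∈_; ∣_∣)
open import Data.Fin.Subset.Properties using (_∈?_)
open import Data.Vec using (Vec; lookup; tabulate; zipWith)
open import Data.Vec.Properties using (≡-dec)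
open import Data.List using (List; []; _∷_; _++_; map; concatMap; foldr; allFin; filter; length)
open import Data.Product using (Σ; ∃; _×_; _,_; proj₁; proj₂)
open import Relation.Nullary using (¬_; Dec; yes; no)
open import Relation.Binary.PropositionalEquality using (_≡_)
import Data.Nat.Properties as ℕP

IsField : ∀ {c ℓ} → CommutativeRing c ℓ → Set (c ⊔ ℓ)
IsField R = (¬ (1# ≈ 0#)) × (∀ x → ¬ (x ≈ 0#) → ∃ λ y → (x * y) ≈ 1#)
  where open CommutativeRing R

-- an involution of [n]: σ ∘ σ = id (hence a permutation)
IsInvolution : ∀ {n} → (Fin n → Fin n) → Set
IsInvolution {n} σ = ∀ i → σ (σ i) ≡ i

numFixedPoints : ∀ {n} → (Fin n → Fin n) → ℕ
numFixedPoints {n} σ = length (filter (λ i → σ i ≟F i) (allFin n))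

-- Polynomials in the n×n matrix of variables x_{i,j} over a commutative
-- ring R, represented as finite formal sums of terms  c · x^m.

module Poly {c ℓ} (R : CommutativeRing c ℓ) (n : ℕ) where
  open CommutativeRing R

  -- exponent matrices; monomial x^m = ∏_{i,j} x_{i,j}^{m i j}
  Mon : Set
  Mon = Vec (Vec ℕ n) n

  _≟M_ : (m m' : Mon) → Dec (m ≡ m')
  _≟M_ = ≡-dec (≡-dec ℕP._≟_)

  _·M_ : Mon → Mon → Mon
  m ·M m' = zipWith (zipWith _+ℕ_) m m'

  sumℕ : List ℕ → ℕ
  sumℕ = foldr _+ℕ_ 0

  degM : Mon → ℕ
  degM m = sumℕ (concatMap (λ i → map (λ j → lookup (lookup m i) j) (allFin n)) (allFin n))

  Poly : Set c
  Poly = List (Carrier × Mon)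

  sumR : List Carrier → Carrier
  sumR = foldr _+_ 0#

  prodR : List Carrier → Carrier
  prodR = foldr _*_ 1#

  coeff : Poly → Mon → Carrier
  coeff p m = sumR (map proj₁ (filter (λ t → proj₂ t ≟M m) p))

  _≃_ : Poly → Poly → Set ℓ
  p ≃ q = ∀ m → coeff p m ≈ coeff q m

  0P : Poly
  0P = []

  _+P_ : Poly → Poly → Poly
  p +P q = p ++ q

  _*P_ : Poly → Poly → Poly
  p *P q = concatMap (λ s → map (λ t → (proj₁ s * proj₁ t , proj₂ s ·M proj₂ t)) q) p

  -P_ : Poly → Poly
  -P p = map (λ t → (- proj₁ t , proj₂ t)) p

  _-P_ : Poly → Poly → Poly
  p -P q = p +P (-P q)

  pow : Carrier → ℕ → Carrier
  pow x zero = 1#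
  pow x (suc k) = x * pow x k

  evalM : (Fin n → Fin n → Carrier) → Mon → Carrier
  evalM z m = prodR (concatMap (λ i → map (λ j → pow (z i j) (lookup (lookup m i) j)) (allFin n)) (allFin n))

  eval : Poly → (Fin n → Fin n → Carrier) → Carrier
  eval p z = sumR (map (λ t → proj₁ t * evalM z (proj₂ t)) p)

  unitMon : Fin n → Fin n → Mon
  unitMon i j = tabulate λ k → tabulate λ l → ind k l
    where
      ind : Fin n → Fin n → ℕ
      ind k l with k ≟F i | l ≟F j
      ... | yes _ | yes _ = 1
      ... | _     | _     = 0

  var : Fin n → Fin n → Poly
  var i j = (1# , unitMon i j) ∷ []

  sumP : List Poly → Poly
  sumP = foldr _+P_ 0P

  constP : Carrier → Poly
  constP r = (r , tabulate λ _ → tabulate λ _ → 0) ∷ []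

  prodP : List Poly → Poly
  prodP = foldr _*P_ (constP 1#)

  rowSum : Fin n → Poly
  rowSum i = sumP (map (λ j → var i j) (allFin n))

  colSum : Fin n → Poly
  colSum j = sumP (map (λ i → var i j) (allFin n))

  diagSum : Poly
  diagSum = sumP (map (λ i → var i i) (allFin n))

  diagProd : Subset n → Poly
  diagProd S = prodP (map (λ i → var i i) (filter (λ i → i ∈? S) (allFin n)))

  data InIdeal (G : Poly → Set (c ⊔ ℓ)) : Poly → Set (c ⊔ ℓ) where
    combo : ∀ (gs : List (Poly × Σ Poly G)) f →
            f ≃ sumP (map (λ t → proj₁ t *P proj₁ (proj₂ t)) gs) →
            InIdeal G f

  Vanishing : ((Fin n → Fin n → Carrier) → Set ℓ) → Poly → Set (c ⊔ ℓ)
  Vanishing Z f = ∀ z → Z z → eval f z ≈ 0#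

  NonZero : Poly → Set ℓ
  NonZero f = ∃ λ m → ¬ (coeff f m ≈ 0#)

  IsTopComponent : Poly → Poly → Set ℓ
  IsTopComponent f h = ∃ λ d →
      (∀ m → ¬ (coeff f m ≈ 0#) → degM m ≤ d)
    × (∃ λ m → degM m ≡ d × ¬ (coeff f m ≈ 0#))
    × (∀ m → degM m ≡ d → coeff h m ≈ coeff f m)
    × (∀ m → ¬ (degM m ≡ d) → coeff h m ≈ 0#)

  gr : (Poly → Set (c ⊔ ℓ)) → Poly → Set (c ⊔ ℓ)
  gr I = InIdeal (λ h → ∃ λ f → I f × NonZero f × IsTopComponent f h)

  _⊆I_ : (Poly → Set (c ⊔ ℓ)) → (Poly → Set (c ⊔ ℓ)) → Set (c ⊔ ℓ)
  I ⊆I J = ∀ f → I f → J f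

  permMatrix : (Fin n → Fin n) → Fin n → Fin n → Carrier
  permMatrix σ i j with σ i ≟F j
  ... | yes _ = 1#
  ... | no _  = 0#

  𝓜 : ℕ → (Fin n → Fin n → Carrier) → Set ℓ
  𝓜 a z = ∃ λ (σ : Fin n → Fin n) → IsInvolution σ × numFixedPoints σ ≡ a
            × (∀ i j → z i j ≈ permMatrix σ i j)

  data GenM (a : ℕ) : Poly → Set (c ⊔ ℓ) where
    row  : ∀ i → GenM a (rowSum i)
    col  : ∀ j → GenM a (colSum j)
    rowProd : ∀ i j j' → ¬ (j ≡ j') → GenM a (var i j *P var i j')
    colProd : ∀ i i' j → ¬ (i ≡ i') → GenM a (var i j *P var i' j)
    symm : ∀ i j → GenM a (var i j -P var j i)
    diag : GenM a diagSum
    diagP : ∀ (S : Subset n) → a < ∣ S ∣ → GenM a (diagProd S)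

  IM : ℕ → Poly → Set (c ⊔ ℓ)
  IM a = InIdeal (GenM a)

{-# OPTIONS --safe #-}
module Submission where

-- Every generator of I^𝓜 is either the zero polynomial (x_ii − x_ii, and the
-- empty diagonal sum when n = 0) or the top-degree component of a polynomial
-- vanishing on 𝓜. The row, column and diagonal sums of a permutation matrix
-- of an involution with a fixed points are the constants 1, 1 and a, so
-- subtracting these constants gives vanishing polynomials with the sums as
-- top components. The remaining generators are homogeneous and already vanish
-- on 𝓜: there is one 1 per row and per column, the matrix is symmetric, and a
-- diagonal monomial in more than a variables meets a non-fixed point.
-- Dropping the zero generators turns every combination of generators of I^𝓜
-- into one of generators of gr I(𝓜). From the field structure only 1 ≉ 0 is
-- used.

open import Defs
open import Algebra.Bundles using (CommutativeMonoid; CommutativeRing)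
open import Data.Bool using (true; false)
open import Data.Fin using (Fin; zero; suc; punchIn)
open import Data.Fin.Properties using (punchInᵢ≢i) renaming (_≟_ to _≟F_)
open import Data.Fin.Subset using (Subset; inside; outside; ∣_∣)
open import Data.Fin.Subset.Properties using (_∈?_)
open import Data.List using (List; []; _∷_; _++_; map; concatMap; foldr; allFin; tabulate; filter; length)
open import Data.List.Properties using (map-tabulate; map-++; filter-++; filter-none)
open import Data.List.Relation.Unary.All as All using (All; []; _∷_)
import Data.List.Relation.Unary.All.Properties as All
open import Data.List.Relation.Unary.Any as Any using (Any; here; there)
open import Data.Nat using (ℕ; zero; suc; _≤_; _<_; _∸_) renaming (_+_ to _+ℕ_)
open import Data.Nat.Divisibility using (_∣_)
import Data.Nat.Properties as ℕP
open import Data.Product using (Σ; ∃; _×_; _,_; proj₁; proj₂; uncurry)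
open import Data.Sum using (_⊎_; inj₁; inj₂)
open import Data.Vec as Vec using ([]; _∷_; lookup; zipWith)
open import Data.Vec.Properties using (lookup∘tabulate; lookup-zipWith)
open import Function using (_∘_; _∋_; id)
open import Level using (_⊔_)
open import Relation.Binary.PropositionalEquality as ≡ using (_≡_; _≢_)
open import Relation.Nullary using (¬_; Dec; does; yes; no; contradiction)
open import Relation.Nullary.Decidable using (_×-dec_; decidable-stable)
open import Relation.Unary using (Pred; Decidable; ∁)

module FoldProperties {a ℓ} (M : CommutativeMonoid a ℓ) where
  open CommutativeMonoid M
  open import Algebra.Properties.CommutativeMonoid.Sum M public
    using (sum; sum-cong-≋; ∑-distrib-+)
  open import Algebra.Properties.CommutativeMonoid.Sum M
    using (sum-remove; sum-cong-≗; sum-replicate-zero)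
  open import Relation.Binary.Reasoning.Setoid setoid

  fold : List Carrier → Carrier
  fold = foldr _∙_ ε

  fold-++ : ∀ xs ys → fold (xs ++ ys) ≈ fold xs ∙ fold ys
  fold-++ []       ys = sym (identityˡ _)
  fold-++ (x ∷ xs) ys = trans (∙-congˡ (fold-++ xs ys)) (sym (assoc _ _ _))

  fold-concatMap : ∀ {a} {A : Set a} (F : A → List Carrier) xs →
                   fold (concatMap F xs) ≈ fold (map (fold ∘ F) xs)
  fold-concatMap F []       = refl
  fold-concatMap F (x ∷ xs) = trans (fold-++ (F x) (concatMap F xs)) (∙-congˡ (fold-concatMap F xs))

  fold-tabulate : ∀ {n} (f : Fin n → Carrier) → fold (tabulate f) ≡ sum f
  fold-tabulate {zero}  f = ≡.refl
  fold-tabulate {suc n} f = ≡.cong (f zero ∙_) (fold-tabulate (f ∘ suc))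

  fold-allFin : ∀ {n} (f : Fin n → Carrier) → fold (map f (allFin n)) ≡ sum f
  fold-allFin f = ≡.trans (≡.cong fold (map-tabulate id f)) (fold-tabulate f)

  fold-allFin² : ∀ {n} (f : Fin n → Fin n → Carrier) →
                 fold (concatMap (λ i → map (f i) (allFin n)) (allFin n)) ≈ sum (λ i → sum (f i))
  fold-allFin² {n} f = begin
    fold (concatMap row (allFin n))  ≈⟨ fold-concatMap row (allFin n) ⟩
    fold (map (fold ∘ row) (allFin n)) ≡⟨ fold-allFin (fold ∘ row) ⟩
    sum (fold ∘ row)                   ≡⟨ sum-cong-≗ (λ i → fold-allFin (f i)) ⟩
    sum (λ i → sum (f i))              ∎
    where
      row : Fin n → List Carrier
      row i = map (f i) (allFin n)

  sum-zero : ∀ {n} (f : Fin n → Carrier) → (∀ k → f k ≈ ε) → sum f ≈ ε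
  sum-zero {n} f f≈ε = trans (sum-cong-≋ f≈ε) (sum-replicate-zero n)

  sum-single : ∀ {n} (f : Fin n → Carrier) j → (∀ k → k ≢ j → f k ≈ ε) → sum f ≈ f j
  sum-single {suc n} f j off = begin
    sum f                      ≈⟨ sum-remove f ⟩
    f j ∙ sum (f ∘ punchIn j)  ≈⟨ ∙-congˡ (sum-zero _ (λ k → off _ (punchInᵢ≢i j k))) ⟩
    f j ∙ ε                    ≈⟨ identityʳ _ ⟩
    f j                        ∎

  sum²-single : ∀ {n} (f : Fin n → Fin n → Carrier) i j →
                (∀ k l → ¬ (k ≡ i × l ≡ j) → f k l ≈ ε) → sum (λ k → sum (f k)) ≈ f i j
  sum²-single f i j off = trans
    (sum-single _ i (λ k k≢i → sum-zero (f k) (λ l → off k l (k≢i ∘ proj₁))))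
    (sum-single (f i) j (λ l l≢j → off i l (l≢j ∘ proj₂)))

Fin⊎allFin≡[] : ∀ n → Fin n ⊎ allFin n ≡ []
Fin⊎allFin≡[] zero    = inj₂ ≡.refl
Fin⊎allFin≡[] (suc n) = inj₁ zero

length-filter<⇒Any∁ : ∀ {a p q} {A : Set a} {P : Pred A p} {Q : Pred A q}
                      (P? : Decidable P) (Q? : Decidable Q) xs →
                      length (filter Q? xs) < length (filter P? xs) → Any (∁ Q) (filter P? xs)
length-filter<⇒Any∁ P? Q? (x ∷ xs) lt with P? x | Q? x
... | yes _ | yes _  = there (length-filter<⇒Any∁ P? Q? xs (ℕP.≤-pred lt))
... | yes _ | no ¬Qx = here ¬Qx
... | no _  | yes _  = length-filter<⇒Any∁ P? Q? xs (ℕP.<-trans (ℕP.n<1+n _) lt)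
... | no _  | no _   = length-filter<⇒Any∁ P? Q? xs lt

length-filter∈?-suc : ∀ {n} x (p : Subset n) ks →
                      length (filter (_∈? x ∷ p) (map suc ks)) ≡ length (filter (_∈? p) ks)
length-filter∈?-suc x p []       = ≡.refl
length-filter∈?-suc x p (k ∷ ks) with does (k ∈? p)
... | true  = ≡.cong suc (length-filter∈?-suc x p ks)
... | false = length-filter∈?-suc x p ks

∣p∣≡length-filter∈ : ∀ {n} (p : Subset n) → ∣ p ∣ ≡ length (filter (_∈? p) (allFin n))
∣p∣≡length-filter∈ []              = ≡.refl
∣p∣≡length-filter∈ {suc n} (x ∷ p) = head-step x (≡.trans (∣p∣≡length-filter∈ p) (≡.sym tail-count))
  where
    tail-count : length (filter (_∈? x ∷ p) (tabulate suc)) ≡ length (filter (_∈? p) (allFin n))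
    tail-count = ≡.trans (≡.cong (length ∘ filter (_∈? x ∷ p)) (≡.sym (map-tabulate id suc)))
                         (length-filter∈?-suc x p (allFin n))
    head-step : ∀ y → ∣ p ∣ ≡ length (filter (_∈? y ∷ p) (tabulate suc)) →
                ∣ y ∷ p ∣ ≡ length (filter (_∈? y ∷ p) (allFin (suc n)))
    head-step inside  = ≡.cong suc
    head-step outside = id

module Monomials {c ℓ} (R : CommutativeRing c ℓ) (n : ℕ) where
  open CommutativeRing R
  open Poly R n
  open import Relation.Binary.Reasoning.Setoid setoid
  private module Π = FoldProperties *-commutativeMonoid
  private module Σℕ = FoldProperties ℕP.+-0-commutativeMonoid

  entry : Mon → Fin n → Fin n → ℕ
  entry m i j = lookup (lookup m i) j

  entry-tabulate : ∀ (F : Fin n → Fin n → ℕ) i j →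
                   entry (Vec.tabulate λ k → Vec.tabulate (F k)) i j ≡ F i j
  entry-tabulate F i j =
    ≡.trans (≡.cong (λ v → lookup v j) (lookup∘tabulate _ i)) (lookup∘tabulate (F i) j)

  entry-·M : ∀ m m′ i j → entry (m ·M m′) i j ≡ entry m i j +ℕ entry m′ i j
  entry-·M m m′ i j = ≡.trans (≡.cong (λ v → lookup v j) (lookup-zipWith (zipWith _+ℕ_) i m m′))
                              (lookup-zipWith _+ℕ_ j (lookup m i) (lookup m′ i))

  constMon : Mon
  constMon = Vec.tabulate λ _ → Vec.tabulate λ _ → 0

  -- The indicator defining unitMon is local to Defs; abstracting the two
  -- comparisons it branches on lets its clauses compute.
  unitMon-on : ∀ i j → entry (unitMon i j) i j ≡ 1
  unitMon-on i j with i ≟F i | j ≟F j | entry (unitMon i j) i j ≡ _ ∋ entry-tabulate _ i j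
  ... | yes _  | yes _  | e = e
  ... | no i≢i | _      | _ = contradiction ≡.refl i≢i
  ... | yes _  | no j≢j | _ = contradiction ≡.refl j≢j

  unitMon-off : ∀ {i j k l} → ¬ (k ≡ i × l ≡ j) → entry (unitMon i j) k l ≡ 0
  unitMon-off {i} {j} {k} {l} ¬kl with k ≟F i | l ≟F j | entry (unitMon i j) k l ≡ _ ∋ entry-tabulate _ k l
  ... | yes k≡i | yes l≡j | _ = contradiction (k≡i , l≡j) ¬kl
  ... | no _    | _       | e = e
  ... | yes _   | no _    | e = e

  unitMon-injective : ∀ {i j k l} → unitMon i j ≡ unitMon k l → i ≡ k × j ≡ l
  unitMon-injective {i} {j} {k} {l} eq with (i ≟F k) ×-dec (j ≟F l)
  ... | yes ij≡kl = ij≡kl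
  ... | no ij≢kl  = contradiction
    (≡.trans (≡.sym (unitMon-on i j)) (≡.trans (≡.cong (λ m → entry m i j) eq) (unitMon-off ij≢kl)))
    ℕP.1+n≢0

  degM-entries : ∀ m → degM m ≡ Σℕ.sum (λ i → Σℕ.sum (entry m i))
  degM-entries m = Σℕ.fold-allFin² (entry m)

  degM-unitMon : ∀ i j → degM (unitMon i j) ≡ 1
  degM-unitMon i j = ≡.trans (degM-entries (unitMon i j))
    (≡.trans (Σℕ.sum²-single _ i j (λ _ _ → unitMon-off)) (unitMon-on i j))

  degM-constMon : degM constMon ≡ 0
  degM-constMon = ≡.trans (degM-entries constMon)
    (Σℕ.sum-zero _ (λ i → Σℕ.sum-zero _ (entry-tabulate (λ _ _ → 0) i)))

  pow-+ : ∀ x p q → pow x (p +ℕ q) ≈ pow x p * pow x q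
  pow-+ x zero    q = sym (*-identityˡ _)
  pow-+ x (suc p) q = trans (*-congˡ (pow-+ x p q)) (sym (*-assoc _ _ _))

  evalM-entries : ∀ z m → evalM z m ≈ Π.sum (λ i → Π.sum (λ j → pow (z i j) (entry m i j)))
  evalM-entries z m = Π.fold-allFin² (λ i j → pow (z i j) (entry m i j))

  evalM-·M : ∀ z m m′ → evalM z (m ·M m′) ≈ evalM z m * evalM z m′
  evalM-·M z m m′ = begin
    evalM z (m ·M m′)
      ≈⟨ evalM-entries z (m ·M m′) ⟩
    Π.sum (λ i → Π.sum (λ j → powₘ (m ·M m′) i j))
      ≈⟨ Π.sum-cong-≋ (λ i → Π.sum-cong-≋ (pow-entry i)) ⟩
    Π.sum (λ i → Π.sum (λ j → powₘ m i j * powₘ m′ i j))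
      ≈⟨ Π.sum-cong-≋ (λ i → Π.∑-distrib-+ (powₘ m i) (powₘ m′ i)) ⟩
    Π.sum (λ i → Π.sum (powₘ m i) * Π.sum (powₘ m′ i))
      ≈⟨ Π.∑-distrib-+ (λ i → Π.sum (powₘ m i)) (λ i → Π.sum (powₘ m′ i)) ⟩
    Π.sum (λ i → Π.sum (powₘ m i)) * Π.sum (λ i → Π.sum (powₘ m′ i))
      ≈⟨ sym (*-cong (evalM-entries z m) (evalM-entries z m′)) ⟩
    evalM z m * evalM z m′
      ∎
    where
      powₘ : Mon → Fin n → Fin n → Carrier
      powₘ m i j = pow (z i j) (entry m i j)
      pow-entry : ∀ i j → powₘ (m ·M m′) i j ≈ powₘ m i j * powₘ m′ i j
      pow-entry i j = trans (reflexive (≡.cong (pow (z i j)) (entry-·M m m′ i j)))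
                            (pow-+ (z i j) (entry m i j) (entry m′ i j))

  evalM-unitMon : ∀ z i j → evalM z (unitMon i j) ≈ z i j
  evalM-unitMon z i j = begin
    evalM z (unitMon i j)
      ≈⟨ evalM-entries z (unitMon i j) ⟩
    Π.sum (λ k → Π.sum (λ l → pow (z k l) (entry (unitMon i j) k l)))
      ≈⟨ Π.sum²-single _ i j (λ k l ¬kl → reflexive (≡.cong (pow (z k l)) (unitMon-off ¬kl))) ⟩
    pow (z i j) (entry (unitMon i j) i j)
      ≡⟨ ≡.cong (pow (z i j)) (unitMon-on i j) ⟩
    z i j * 1#
      ≈⟨ *-identityʳ (z i j) ⟩
    z i j
      ∎

  evalM-constMon : ∀ z → evalM z constMon ≈ 1#
  evalM-constMon z = trans (evalM-entries z constMon) (Π.sum-zero _ λ i → Π.sum-zero _ λ j →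
    reflexive (≡.cong (pow (z i j)) (entry-tabulate (λ _ _ → 0) i j)))

  evalM-unitMon² : ∀ z i j k l → evalM z (unitMon i j ·M unitMon k l) ≈ z i j * z k l
  evalM-unitMon² z i j k l =
    trans (evalM-·M z (unitMon i j) (unitMon k l)) (*-cong (evalM-unitMon z i j) (evalM-unitMon z k l))

module Polynomials {c ℓ} (R : CommutativeRing c ℓ) (n : ℕ) where
  open CommutativeRing R
  open Poly R n
  open Monomials R n
  open import Relation.Binary.Reasoning.Setoid setoid
  private module ΣR = FoldProperties +-commutativeMonoid

  IsZero : Poly → Set ℓ
  IsZero p = ∀ m → coeff p m ≈ 0#

  coeff-++ : ∀ p q m → coeff (p ++ q) m ≈ coeff p m + coeff q m
  coeff-++ p q m = begin
    sumR (map proj₁ (filter P? (p ++ q)))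
      ≡⟨ ≡.cong (sumR ∘ map proj₁) (filter-++ P? p q) ⟩
    sumR (map proj₁ (filter P? p ++ filter P? q))
      ≡⟨ ≡.cong sumR (map-++ proj₁ (filter P? p) (filter P? q)) ⟩
    sumR (map proj₁ (filter P? p) ++ map proj₁ (filter P? q))
      ≈⟨ ΣR.fold-++ (map proj₁ (filter P? p)) _ ⟩
    coeff p m + coeff q m
      ∎
    where
      P? : (t : Carrier × Mon) → Dec (proj₂ t ≡ m)
      P? t = proj₂ t ≟M m

  coeff-none : ∀ p m → All (λ t → proj₂ t ≢ m) p → coeff p m ≡ 0#
  coeff-none p m none = ≡.cong (sumR ∘ map proj₁) (filter-none (λ t → proj₂ t ≟M m) none)

  coeff-single : ∀ r M → coeff ((r , M) ∷ []) M ≈ r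
  coeff-single r M with M ≟M M
  ... | yes _  = +-identityʳ r
  ... | no M≢M = contradiction ≡.refl M≢M

  coeff-single-≢ : ∀ {r M m} → M ≢ m → coeff ((r , M) ∷ []) m ≈ 0#
  coeff-single-≢ M≢m = reflexive (coeff-none _ _ (M≢m ∷ []))

  coeff-map : ∀ {a} {A : Set a} (t : A → Carrier × Mon) xs m →
              coeff (map t xs) m ≈ sumR (map (λ x → coeff (t x ∷ []) m) xs)
  coeff-map t []       m = refl
  coeff-map t (x ∷ xs) m = trans (coeff-++ (t x ∷ []) (map t xs) m) (+-congˡ (coeff-map t xs m))

  coeff-cancel : ∀ {r r′} M → r + r′ ≈ 0# → IsZero ((r , M) ∷ (r′ , M) ∷ [])
  coeff-cancel {r} {r′} M r+r′≈0 m = trans (coeff-++ ((r , M) ∷ []) ((r′ , M) ∷ []) m) (cancel (M ≟M m))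
    where
      cancel : Dec (M ≡ m) → coeff ((r , M) ∷ []) m + coeff ((r′ , M) ∷ []) m ≈ 0#
      cancel (yes M≡m) = ≡.subst (λ m → coeff ((r , M) ∷ []) m + coeff ((r′ , M) ∷ []) m ≈ 0#) M≡m
        (trans (+-cong (coeff-single r M) (coeff-single r′ M)) r+r′≈0)
      cancel (no M≢m)  = trans (+-cong (coeff-single-≢ M≢m) (coeff-single-≢ M≢m)) (+-identityʳ 0#)

  IsZero-concatMap : ∀ {a} {A : Set a} (F : A → Poly) → (∀ x → IsZero (F x)) → ∀ xs → IsZero (concatMap F xs)
  IsZero-concatMap F zero-F []       m = refl
  IsZero-concatMap F zero-F (x ∷ xs) m = trans (coeff-++ (F x) (concatMap F xs) m)
    (trans (+-cong (zero-F x m) (IsZero-concatMap F zero-F xs m)) (+-identityʳ 0#))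

  IsZero-*P-var-cancel : ∀ i j q → IsZero (q *P (var i j -P var i j))
  IsZero-*P-var-cancel i j = IsZero-concatMap _ λ (r , M) → coeff-cancel (M ·M unitMon i j)
    (trans (sym (distribˡ r 1# (- 1#))) (trans (*-congˡ (-‿inverseʳ 1#)) (zeroʳ r)))

  eval-++ : ∀ p q z → eval (p ++ q) z ≈ eval p z + eval q z
  eval-++ p q z = trans (reflexive (≡.cong sumR (map-++ term p q))) (ΣR.fold-++ (map term p) (map term q))
    where
      term : Carrier × Mon → Carrier
      term t = proj₁ t * evalM z (proj₂ t)

  eval-vars : ∀ {a} {A : Set a} (ρ κ : A → Fin n) xs z →
              eval (map (λ x → (1# , unitMon (ρ x) (κ x))) xs) z ≈ sumR (map (λ x → z (ρ x) (κ x)) xs)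
  eval-vars ρ κ []       z = refl
  eval-vars ρ κ (x ∷ xs) z =
    +-cong (trans (*-identityˡ _) (evalM-unitMon z (ρ x) (κ x))) (eval-vars ρ κ xs z)

  prodP-vars : ∀ {a} {A : Set a} (ρ κ : A → Fin n) xs → ∃ λ r → ∃ λ M →
               prodP (map (λ x → var (ρ x) (κ x)) xs) ≡ (r , M) ∷ [] × r ≈ 1# ×
               (∀ z → evalM z M ≈ prodR (map (λ x → z (ρ x) (κ x)) xs))
  prodP-vars ρ κ [] = 1# , constMon , ≡.refl , refl , evalM-constMon
  prodP-vars ρ κ (x ∷ xs) with prodP-vars ρ κ xs
  ... | r , M , ≡single , r≈1 , evalM-M =
    1# * r , unitMon (ρ x) (κ x) ·M M , ≡.cong (var (ρ x) (κ x) *P_) ≡single , trans (*-identityˡ r) r≈1 ,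
    λ z → trans (evalM-·M z (unitMon (ρ x) (κ x)) M) (*-cong (evalM-unitMon z (ρ x) (κ x)) (evalM-M z))

  prodR-zero : ∀ {a} {A : Set a} (f : A → Carrier) {xs} → Any (λ x → f x ≈ 0#) xs → prodR (map f xs) ≈ 0#
  prodR-zero f (here fx≈0)   = trans (*-congʳ fx≈0) (zeroˡ _)
  prodR-zero f (there any≈0) = trans (*-congˡ (prodR-zero f any≈0)) (zeroʳ _)

  sumP-singletons : ∀ {a} {A : Set a} (t : A → Carrier × Mon) xs → sumP (map (λ x → t x ∷ []) xs) ≡ map t xs
  sumP-singletons t []       = ≡.refl
  sumP-singletons t (x ∷ xs) = ≡.cong (t x ∷_) (sumP-singletons t xs)

  InIdeal-mono : ∀ {G G′ : Poly → Set (c ⊔ ℓ)} → (∀ {g} → G g → G′ g ⊎ (∀ q → IsZero (q *P g))) →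
                 ∀ f → InIdeal G f → InIdeal G′ f
  InIdeal-mono {G} {G′} classify f (combo gs .f f≃gs) =
    combo (proj₁ (drop gs)) f (λ m → trans (f≃gs m) (proj₂ (drop gs) m))
    where
      combination : ∀ {H : Poly → Set (c ⊔ ℓ)} → List (Poly × Σ Poly H) → Poly
      combination gs = sumP (map (λ t → proj₁ t *P proj₁ (proj₂ t)) gs)

      drop : (gs : List (Poly × Σ Poly G)) →
             Σ (List (Poly × Σ Poly G′)) λ gs′ → combination gs ≃ combination gs′
      drop [] = [] , λ m → refl
      drop ((q , g , G-g) ∷ gs) with drop gs | classify G-g
      ... | gs′ , ≃gs′ | inj₁ G′-g  = (q , g , G′-g) ∷ gs′ , λ m →
        trans (coeff-++ (q *P g) _ m) (trans (+-congˡ (≃gs′ m)) (sym (coeff-++ (q *P g) _ m)))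
      ... | gs′ , ≃gs′ | inj₂ q*g≈0 = gs′ , λ m →
        trans (coeff-++ (q *P g) _ m) (trans (+-cong (q*g≈0 q m) (≃gs′ m)) (+-identityˡ _))

module TopComponents {c ℓ} (R : CommutativeRing c ℓ) (n : ℕ) where
  open CommutativeRing R
  open Poly R n
  open Monomials R n
  open Polynomials R n
  open import Relation.Binary.Reasoning.Setoid setoid
  open import Algebra.Properties.Ring ring using (-1*x≈-x)
  private module ΣR = FoldProperties +-commutativeMonoid

  Homogeneous : ℕ → Poly → Set c
  Homogeneous d = All (λ t → degM (proj₂ t) ≡ d)

  DegreeBelow : ℕ → Poly → Set c
  DegreeBelow d = All (λ t → degM (proj₂ t) < d)

  TopComponentIn : (Poly → Set (c ⊔ ℓ)) → Poly → Set (c ⊔ ℓ)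
  TopComponentIn I h = ∃ λ f → I f × NonZero f × IsTopComponent f h

  homogeneous-coeff : ∀ {d g m} → Homogeneous d g → degM m ≢ d → coeff g m ≈ 0#
  homogeneous-coeff {d} {g} {m} hom ≢d =
    reflexive (coeff-none g m (All.map (λ ≡d M≡m → ≢d (≡.trans (≡.cong degM (≡.sym M≡m)) ≡d)) hom))

  coeff-++-below : ∀ {d lower m} g → DegreeBelow d lower → d ≤ degM m → coeff (g ++ lower) m ≈ coeff g m
  coeff-++-below {d} {lower} {m} g below d≤ = begin
    coeff (g ++ lower) m       ≈⟨ coeff-++ g lower m ⟩
    coeff g m + coeff lower m  ≡⟨ ≡.cong (coeff g m +_) (coeff-none lower m (All.map (λ {t} → not-m t) below)) ⟩
    coeff g m + 0#             ≈⟨ +-identityʳ _ ⟩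
    coeff g m                  ∎
    where
      not-m : ∀ t → degM (proj₂ t) < d → proj₂ t ≢ m
      not-m t <d M≡m = ℕP.<⇒≱ (≡.subst (_< d) (≡.cong degM M≡m) <d) d≤

  homogeneous-top : ∀ {I : Poly → Set (c ⊔ ℓ)} {d g lower m} → Homogeneous d g → DegreeBelow d lower →
                    ¬ coeff g m ≈ 0# → I (g ++ lower) → TopComponentIn I g
  homogeneous-top {d = d} {g} {lower} {m} hom below g[m]≉0 I-f =
    g ++ lower , I-f , (m , f[m]≉0) , d , bounded , (m , deg-m , f[m]≉0) , same , other
    where
      deg-m : degM m ≡ d
      deg-m = decidable-stable (degM m ℕP.≟ d) (λ ≢d → g[m]≉0 (homogeneous-coeff hom ≢d))
      same : ∀ m′ → degM m′ ≡ d → coeff g m′ ≈ coeff (g ++ lower) m′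
      same m′ ≡d = sym (coeff-++-below g below (ℕP.≤-reflexive (≡.sym ≡d)))
      f[m]≉0 : ¬ coeff (g ++ lower) m ≈ 0#
      f[m]≉0 = g[m]≉0 ∘ trans (same m deg-m)
      other : ∀ m′ → degM m′ ≢ d → coeff g m′ ≈ 0#
      other _ = homogeneous-coeff hom
      bounded : ∀ m′ → ¬ coeff (g ++ lower) m′ ≈ 0# → degM m′ ≤ d
      bounded m′ f[m′]≉0 = decidable-stable (degM m′ ℕP.≤? d) λ ≰d →
        f[m′]≉0 (trans (coeff-++-below g below (ℕP.<⇒≤ (ℕP.≰⇒> ≰d)))
                       (other m′ (≰d ∘ ℕP.≤-reflexive)))

  module _ (1≉0 : ¬ 1# ≈ 0#) {Z : (Fin n → Fin n → Carrier) → Set ℓ} where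

    vanishing-monomial-top : ∀ {r} M → r ≈ 1# → (∀ z → Z z → evalM z M ≈ 0#) →
                             TopComponentIn (Vanishing Z) ((r , M) ∷ [])
    vanishing-monomial-top {r} M r≈1 M-vanishes =
      homogeneous-top {g = (r , M) ∷ []} {m = M} (≡.refl ∷ []) [] r≉0 vanishes
      where
        r≉0 : ¬ coeff ((r , M) ∷ []) M ≈ 0#
        r≉0 r≈0 = 1≉0 (trans (sym r≈1) (trans (sym (coeff-single r M)) r≈0))
        vanishes : Vanishing Z ((r , M) ∷ [])
        vanishes z z∈Z = trans (+-identityʳ _) (trans (*-congˡ (M-vanishes z z∈Z)) (zeroʳ r))

    linear-form-top : (ρ κ : Fin n → Fin n) → (∀ k k′ → ρ k ≡ ρ k′ → κ k ≡ κ k′ → k ≡ k′) →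
                      Fin n → ∀ r →
                      (∀ z → Z z → sumR (map (λ k → z (ρ k) (κ k)) (allFin n)) ≈ r) →
                      TopComponentIn (Vanishing Z) (sumP (map (λ k → var (ρ k) (κ k)) (allFin n)))
    linear-form-top ρ κ injective k₀ r value =
      ≡.subst (TopComponentIn (Vanishing Z)) (≡.sym (sumP-singletons term (allFin n)))
        (homogeneous-top hom below g[m₀]≉0 vanishes)
      where
        term : Fin n → Carrier × Mon
        term k = 1# , unitMon (ρ k) (κ k)
        g : Poly
        g = map term (allFin n)
        m₀ : Mon
        m₀ = unitMon (ρ k₀) (κ k₀)
        hom : Homogeneous 1 g
        hom = All.map⁺ (All.universal (λ k → degM-unitMon (ρ k) (κ k)) (allFin n))
        below : DegreeBelow 1 ((- r , constMon) ∷ [])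
        below = ℕP.≤-reflexive (≡.cong suc degM-constMon) ∷ []
        term[m₀] : Fin n → Carrier
        term[m₀] k = coeff (term k ∷ []) m₀
        other-terms : ∀ k → k ≢ k₀ → term[m₀] k ≈ 0#
        other-terms k k≢k₀ = coeff-single-≢ (k≢k₀ ∘ uncurry (injective k k₀) ∘ unitMon-injective)
        g[m₀]≉0 : ¬ coeff g m₀ ≈ 0#
        g[m₀]≉0 g≈0 = 1≉0 (begin
          1#                                ≈⟨ coeff-single 1# m₀ ⟨
          coeff (term k₀ ∷ []) m₀           ≈⟨ ΣR.sum-single term[m₀] k₀ other-terms ⟨
          ΣR.sum term[m₀]                   ≡⟨ ΣR.fold-allFin term[m₀] ⟨
          sumR (map term[m₀] (allFin n))    ≈⟨ coeff-map term (allFin n) m₀ ⟨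
          coeff g m₀                        ≈⟨ g≈0 ⟩
          0#                                ∎)
        vanishes : Vanishing Z (g ++ (- r , constMon) ∷ [])
        vanishes z z∈Z = begin
          eval (g ++ (- r , constMon) ∷ []) z
            ≈⟨ eval-++ g _ z ⟩
          eval g z + (- r * evalM z constMon + 0#)
            ≈⟨ +-cong (trans (eval-vars ρ κ (allFin n) z) (value z z∈Z))
                      (trans (+-identityʳ _) (trans (*-congˡ (evalM-constMon z)) (*-identityʳ _))) ⟩
          r + - r
            ≈⟨ -‿inverseʳ r ⟩
          0#
            ∎

    var-difference-top : ∀ {i j k l} → ¬ (k ≡ i × l ≡ j) → (∀ z → Z z → z i j ≈ z k l) →
                         TopComponentIn (Vanishing Z) (var i j -P var k l)
    var-difference-top {i} {j} {k} {l} kl≢ij equal = homogeneous-top hom [] g[ij]≉0 vanishes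
      where
        hom : Homogeneous 1 (var i j -P var k l)
        hom = degM-unitMon i j ∷ degM-unitMon k l ∷ []
        g[ij]≉0 : ¬ coeff (var i j -P var k l) (unitMon i j) ≈ 0#
        g[ij]≉0 g≈0 = 1≉0 (begin
          1#                                        ≈⟨ coeff-single 1# (unitMon i j) ⟨
          coeff (var i j) (unitMon i j)             ≈⟨ +-identityʳ _ ⟨
          coeff (var i j) (unitMon i j) + 0#        ≈⟨ +-congˡ (coeff-single-≢ (kl≢ij ∘ unitMon-injective)) ⟨
          coeff (var i j) (unitMon i j) + coeff ((- 1# , unitMon k l) ∷ []) (unitMon i j)
                                                    ≈⟨ coeff-++ (var i j) _ (unitMon i j) ⟨
          coeff (var i j -P var k l) (unitMon i j)  ≈⟨ g≈0 ⟩
          0#                                        ∎)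
        vanishes : Vanishing Z (var i j -P var k l)
        vanishes z z∈Z = begin
          1# * evalM z (unitMon i j) + (- 1# * evalM z (unitMon k l) + 0#)
            ≈⟨ +-cong (trans (*-identityˡ _) (evalM-unitMon z i j))
                      (trans (+-identityʳ _) (*-congˡ (evalM-unitMon z k l))) ⟩
          z i j + - 1# * z k l  ≈⟨ +-congˡ (-1*x≈-x (z k l)) ⟩
          z i j + - z k l       ≈⟨ +-congʳ (equal z z∈Z) ⟩
          z k l + - z k l       ≈⟨ -‿inverseʳ _ ⟩
          0#                    ∎

module InvolutionMatrix {c ℓ} (R : CommutativeRing c ℓ) (n : ℕ) where
  open CommutativeRing R
  open Poly R n
  open Polynomials R n using (prodR-zero)
  open import Algebra.Definitions.RawMonoid +-rawMonoid using () renaming (_×_ to _×ℕ_)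
  private module ΣR = FoldProperties +-commutativeMonoid

  permMatrix-on : ∀ σ {i j} → σ i ≡ j → permMatrix σ i j ≡ 1#
  permMatrix-on σ {i} {j} σi≡j with σ i ≟F j
  ... | yes _   = ≡.refl
  ... | no σi≢j = contradiction σi≡j σi≢j

  permMatrix-off : ∀ σ {i j} → σ i ≢ j → permMatrix σ i j ≡ 0#
  permMatrix-off σ {i} {j} σi≢j with σ i ≟F j
  ... | yes σi≡j = contradiction σi≡j σi≢j
  ... | no _     = ≡.refl

  module _ (σ : Fin n → Fin n) (involution : IsInvolution σ)
           {z : Fin n → Fin n → Carrier} (z≈ : ∀ i j → z i j ≈ permMatrix σ i j) where

    entry-on : ∀ {i j} → σ i ≡ j → z i j ≈ 1#
    entry-on σi≡j = trans (z≈ _ _) (reflexive (permMatrix-on σ σi≡j))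

    entry-off : ∀ {i j} → σ i ≢ j → z i j ≈ 0#
    entry-off σi≢j = trans (z≈ _ _) (reflexive (permMatrix-off σ σi≢j))

    σ-swap : ∀ {i j} → σ i ≡ j → σ j ≡ i
    σ-swap {i} σi≡j = ≡.trans (≡.cong σ (≡.sym σi≡j)) (involution i)

    row-sum : ∀ i → sumR (map (z i) (allFin n)) ≈ 1#
    row-sum i = trans (reflexive (ΣR.fold-allFin (z i)))
      (trans (ΣR.sum-single (z i) (σ i) (λ k k≢σi → entry-off (k≢σi ∘ ≡.sym))) (entry-on ≡.refl))

    col-sum : ∀ j → sumR (map (λ k → z k j) (allFin n)) ≈ 1#
    col-sum j = trans (reflexive (ΣR.fold-allFin (λ k → z k j)))
      (trans (ΣR.sum-single (λ k → z k j) (σ j) (λ k k≢σj → entry-off (k≢σj ∘ ≡.sym ∘ σ-swap)))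
             (entry-on (involution j)))

    product-off : ∀ {i j i′ j′} → σ i ≢ j ⊎ σ i′ ≢ j′ → z i j * z i′ j′ ≈ 0#
    product-off (inj₁ σi≢j)   = trans (*-congʳ (entry-off σi≢j)) (zeroˡ _)
    product-off (inj₂ σi′≢j′) = trans (*-congˡ (entry-off σi′≢j′)) (zeroʳ _)

    row-product : ∀ i {j j′} → j ≢ j′ → z i j * z i j′ ≈ 0#
    row-product i {j} j≢j′ with σ i ≟F j
    ... | yes σi≡j = product-off (inj₂ (j≢j′ ∘ ≡.trans (≡.sym σi≡j)))
    ... | no σi≢j  = product-off (inj₁ σi≢j)

    col-product : ∀ {i i′} j → i ≢ i′ → z i j * z i′ j ≈ 0#
    col-product {i} {i′} j i≢i′ with σ i ≟F j
    ... | yes σi≡j = product-off (inj₂ λ σi′≡j → i≢i′ (≡.trans (≡.sym (σ-swap σi≡j)) (σ-swap σi′≡j)))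
    ... | no σi≢j  = product-off (inj₁ σi≢j)

    symmetric : ∀ i j → z i j ≈ z j i
    symmetric i j with σ i ≟F j
    ... | yes σi≡j = trans (entry-on σi≡j) (sym (entry-on (σ-swap σi≡j)))
    ... | no σi≢j  = trans (entry-off σi≢j) (sym (entry-off (σi≢j ∘ σ-swap)))

    trace : ∀ xs → sumR (map (λ i → z i i) xs) ≈ length (filter (λ i → σ i ≟F i) xs) ×ℕ 1#
    trace []       = refl
    trace (x ∷ xs) with σ x ≟F x
    ... | yes σx≡x = +-cong (entry-on σx≡x) (trace xs)
    ... | no σx≢x  = trans (+-cong (entry-off σx≢x) (trace xs)) (+-identityˡ _)

    diagonal-product : ∀ S → numFixedPoints σ < ∣ S ∣ →
                       prodR (map (λ i → z i i) (filter (_∈? S) (allFin n))) ≈ 0#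
    diagonal-product S #fix<∣S∣ = prodR-zero (λ i → z i i) (Any.map entry-off
      (length-filter<⇒Any∁ (_∈? S) (λ i → σ i ≟F i) (allFin n)
        (≡.subst (_ <_) (∣p∣≡length-filter∈ S) #fix<∣S∣)))

module Generators {c ℓ} (R : CommutativeRing c ℓ) (n a : ℕ) where
  open CommutativeRing R
  open Poly R n
  open Monomials R n
  open Polynomials R n
  open TopComponents R n
  open InvolutionMatrix R n
  open import Algebra.Definitions.RawMonoid +-rawMonoid using () renaming (_×_ to _×ℕ_)

  module _ (1≉0 : ¬ 1# ≈ 0#) where

    row-top : ∀ i → TopComponentIn (Vanishing (𝓜 a)) (rowSum i)
    row-top i = linear-form-top 1≉0 (λ _ → i) id (λ _ _ _ k≡k′ → k≡k′) i 1#
      λ { z (σ , inv , _ , z≈) → row-sum σ inv z≈ i }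

    col-top : ∀ j → TopComponentIn (Vanishing (𝓜 a)) (colSum j)
    col-top j = linear-form-top 1≉0 id (λ _ → j) (λ _ _ k≡k′ _ → k≡k′) j 1#
      λ { z (σ , inv , _ , z≈) → col-sum σ inv z≈ j }

    diag-top : Fin n → TopComponentIn (Vanishing (𝓜 a)) diagSum
    diag-top k₀ = linear-form-top 1≉0 id id (λ _ _ k≡k′ _ → k≡k′) k₀ (a ×ℕ 1#)
      λ { z (σ , inv , #fix≡a , z≈) →
            trans (trace σ inv z≈ (allFin n)) (reflexive (≡.cong (_×ℕ 1#) #fix≡a)) }

    rowProd-top : ∀ i j j′ → j ≢ j′ → TopComponentIn (Vanishing (𝓜 a)) (var i j *P var i j′)
    rowProd-top i j j′ j≢j′ = vanishing-monomial-top 1≉0 (unitMon i j ·M unitMon i j′) (*-identityˡ 1#)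
      λ { z (σ , inv , _ , z≈) → trans (evalM-unitMon² z i j i j′) (row-product σ inv z≈ i j≢j′) }

    colProd-top : ∀ i i′ j → i ≢ i′ → TopComponentIn (Vanishing (𝓜 a)) (var i j *P var i′ j)
    colProd-top i i′ j i≢i′ = vanishing-monomial-top 1≉0 (unitMon i j ·M unitMon i′ j) (*-identityˡ 1#)
      λ { z (σ , inv , _ , z≈) → trans (evalM-unitMon² z i j i′ j) (col-product σ inv z≈ j i≢i′) }

    diagProd-top : ∀ S → a < ∣ S ∣ → TopComponentIn (Vanishing (𝓜 a)) (diagProd S)
    diagProd-top S a<∣S∣ with prodP-vars id id (filter (_∈? S) (allFin n))
    ... | r , M , ≡single , r≈1 , evalM-M =
      ≡.subst (TopComponentIn (Vanishing (𝓜 a))) (≡.sym ≡single) (vanishing-monomial-top 1≉0 M r≈1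
        λ { z (σ , inv , #fix≡a , z≈) →
              trans (evalM-M z) (diagonal-product σ inv z≈ S (≡.subst (_< ∣ S ∣) (≡.sym #fix≡a) a<∣S∣)) })

    symm-top-or-zero : ∀ i j → TopComponentIn (Vanishing (𝓜 a)) (var i j -P var j i)
                                ⊎ (∀ q → IsZero (q *P (var i j -P var j i)))
    symm-top-or-zero i j with i ≟F j
    ... | yes ≡.refl = inj₂ (IsZero-*P-var-cancel i i)
    ... | no i≢j     = inj₁ (var-difference-top 1≉0 (i≢j ∘ proj₂)
                               λ { z (σ , inv , _ , z≈) → symmetric σ inv z≈ i j })

    diag-top-or-zero : TopComponentIn (Vanishing (𝓜 a)) diagSum ⊎ (∀ q → IsZero (q *P diagSum))
    diag-top-or-zero with Fin⊎allFin≡[] n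
    ... | inj₁ k₀      = inj₁ (diag-top k₀)
    ... | inj₂ allFin≡ = inj₂ λ q →
      ≡.subst (λ ks → IsZero (q *P sumP (map (λ i → var i i) ks))) (≡.sym allFin≡)
              (IsZero-concatMap (λ _ → 0P) (λ _ _ → refl) q)

    generator-top-or-zero : ∀ {g} → GenM a g → TopComponentIn (Vanishing (𝓜 a)) g ⊎ (∀ q → IsZero (q *P g))
    generator-top-or-zero (row i)               = inj₁ (row-top i)
    generator-top-or-zero (col j)               = inj₁ (col-top j)
    generator-top-or-zero (rowProd i j j′ j≢j′) = inj₁ (rowProd-top i j j′ j≢j′)
    generator-top-or-zero (colProd i i′ j i≢i′) = inj₁ (colProd-top i i′ j i≢i′)
    generator-top-or-zero (symm i j)            = symm-top-or-zero i j
    generator-top-or-zero diag                  = diag-top-or-zero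
    generator-top-or-zero (diagP S a<∣S∣)       = inj₁ (diagProd-top S a<∣S∣)

lemma5p5 : ∀ {c ℓ} (R : CommutativeRing c ℓ) → IsField R →
    ∀ (n a : ℕ) → a ≤ n → 2 ∣ (n ∸ a) →
    let open Poly R n in IM a ⊆I gr (Vanishing (𝓜 a))
lemma5p5 R (1≉0 , _) n a _ _ =
  Polynomials.InIdeal-mono R n (Generators.generator-top-or-zero R n a 1≉0)
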